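{- Let $N,t,m,v,\lambda$ be positive integers with $2\le t\le m(t-1)$. There exists an $OCA_{\lambda}(N;t,m,t,v)$ if and only if there exists an $OCA_{\lambda}(N;t,m,t-1,v)$.
   Context: For positive integers $m,s$, an RT poset $\Omega[m,s]$ is a poset on $ms$ elements that is a disjoint union of $m$ chains (blocks) of $s$ elements each, elements in different blocks being incomparable. An ideal is a subset $I$ such that $b\in I$ and $a\preceq b$ imply $a\in I$; an anti-ideal is the complement of an ideal. Ordered covering array: for positive integers $t,m,s,v,\lambda,N$ with $2\le t\le ms$, an $OCA_{\lambda}(N;t,m,s,v)$ is an $N\times ms$ array with entries from an alphabet of size $v$ whose columns are labeled by the elements of an RT poset $\Omega[m,s]$, such that for every anti-ideal $J$ with $|J|=t$, the $N\times t$ subarray formed by the columns labeled by $J$ contains every $t$-tuple over the alphabet as a row at least $\lambda$ times. When $s=1$ this is a covering array. -}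

module Defs where

open import Data.Nat using (ℕ; _≤_; _*_; _+_)
open import Data.Bool using (Bool; true; false; not; T)
open import Data.Fin using (Fin)
import Data.Fin as F
open import Data.Fin.Properties using (all?)
open import Data.List using (List; length; filter; map; allFin)
open import Data.Nat.ListAction using (sum)
open import Data.Product using (Σ; _×_)
open import Relation.Binary.PropositionalEquality using (_≡_)
open import Relation.Nullary.Decidable using (Dec; _→-dec_)
open import Data.Fin.Properties using (_≟_)

-- Subsets of the RT poset Ω[m,s]: element (i , a) is the a-th element of block i,
-- and (i , a) ⪯ (j , b) iff i ≡ j and a ≤ b (as elements of Fin s).
PSubset : ℕ → ℕ → Set
PSubset m s = Fin m → Fin s → Bool

IsIdeal : ∀ {m s} → PSubset m s → Set
IsIdeal {m} {s} I = ∀ (i : Fin m) (a b : Fin s) → a F.≤ b → T (I i b) → T (I i a)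

IsAntiIdeal : ∀ {m s} → PSubset m s → Set
IsAntiIdeal {m} {s} J =
  Σ (PSubset m s) λ I → IsIdeal I × (∀ i a → J i a ≡ not (I i a))

card : ∀ {m s} → PSubset m s → ℕ
card {m} {s} J = sum (map (λ i → length (filter (λ a → T? (J i a)) (allFin s))) (allFin m))
  where
  T? : (b : Bool) → Dec (T b)
  T? = Data.Bool.T?

Array : ℕ → ℕ → ℕ → ℕ → Set
Array N m s v = Fin N → Fin m → Fin s → Fin v

RowMatches : ∀ {N m s v} → Array N m s v → PSubset m s → (Fin m → Fin s → Fin v) → Fin N → Set
RowMatches A J g r = ∀ i a → T (J i a) → A r i a ≡ g i a

rowMatches? : ∀ {N m s v} (A : Array N m s v) J g r → Dec (RowMatches A J g r)
rowMatches? A J g r =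
  all? λ i → all? λ a → Data.Bool.T? (J i a) →-dec (A r i a ≟ g i a)

countRows : ∀ {N m s v} → Array N m s v → PSubset m s → (Fin m → Fin s → Fin v) → ℕ
countRows {N} A J g = length (filter (rowMatches? A J g) (allFin N))

-- OCA_λ(N; t, m, s, v).  A t-tuple on the columns of J is represented by any
-- labelling g of all columns, only its restriction to J mattering.
IsOCA : (λ' N t m s v : ℕ) → Array N m s v → Set
IsOCA λ' N t m s v A =
  (2 ≤ t) × (t ≤ m * s) ×
  (∀ (J : PSubset m s) → IsAntiIdeal J → card J ≡ t →
     ∀ (g : Fin m → Fin s → Fin v) → λ' ≤ countRows A J g)

OCAExists : (λ' N t m s v : ℕ) → Set
OCAExists λ' N t m s v = Σ (Array N m s v) (IsOCA λ' N t m s v)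

-- Deleting the bottom element of every block turns an OCA on Ω[m,t] into one on Ω[m,t-1],
-- because an anti-ideal of Ω[m,t-1] is an anti-ideal of the top t-1 levels of Ω[m,t].
-- Conversely, give every block a new bottom element whose column copies the column of the
-- top element of some other block. An anti-ideal of size t of Ω[m,t] either avoids the
-- bottom level, and is then an old anti-ideal, or contains the bottom of a block i; being
-- upward closed of size t it is then exactly block i, whose columns are those of block i
-- of Ω[m,t-1] together with the top of the other block: again an anti-ideal of size t.
module Submission where

open import Defs
open import Data.Bool using (Bool; true; false; not; T; if_then_else_; _∨_; _∧_)
import Data.Bool as Bool
open import Data.Bool.Properties using (T-≡; T-not-≡; ¬-not; not-involutive; ∨-zeroʳ)
open import Data.Empty using (⊥-elim)
open import Data.Fin using (Fin; zero; suc; fromℕ)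
import Data.Fin as F
open import Data.Fin.Properties using (_≟_; any?; ≤fromℕ)
import Data.Fin.Properties as F
open import Data.List using (length; filter; map; tabulate; allFin)
open import Data.List.Relation.Binary.Sublist.Propositional.Properties
  using (filter⁺; length-mono-≤)
open import Data.List.Relation.Binary.Sublist.Propositional using (⊆-refl)
open import Data.Nat using (ℕ; zero; suc; _≤_; _*_; _∸_; _+_; z≤n; s≤s)
open import Data.Nat.ListAction using (sum)
open import Data.Nat.Properties
  using (+-comm; +-identityʳ; *-identityʳ; *-zeroʳ; *-identityˡ; ≤-trans; m≤m+n; m≤n+m;
         +-monoʳ-≤; +-cancelʳ-≤; n≤0⇒n≡0; n≮n)
open import Data.Product using (_×_; _,_; proj₁; proj₂)
open import Data.Sum using (_⊎_; inj₁; inj₂; [_,_])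
open import Function using (_∘_; id)
open import Function.Bundles using (_⇔_; mk⇔; Equivalence)
open import Relation.Binary.PropositionalEquality
  using (_≡_; _≢_; refl; sym; trans; cong; cong₂; subst; subst₂; module ≡-Reasoning)
open import Relation.Nullary using (¬_; yes; no; does)
open import Relation.Nullary.Decidable using (dec-true; dec-false)

open Equivalence using (to; from)

∑ : (n : ℕ) → (Fin n → ℕ) → ℕ
∑ zero    f = 0
∑ (suc n) f = f zero + ∑ n (f ∘ suc)

∑-cong : ∀ n {f g : Fin n → ℕ} → (∀ i → f i ≡ g i) → ∑ n f ≡ ∑ n g
∑-cong zero    f≗g = refl
∑-cong (suc n) f≗g = cong₂ _+_ (f≗g zero) (∑-cong n (f≗g ∘ suc))

∑-const : ∀ n c → ∑ n (λ _ → c) ≡ n * c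
∑-const zero    c = refl
∑-const (suc n) c = cong (c +_) (∑-const n c)

∑-supported : ∀ n (f : Fin n → ℕ) i → (∀ k → k ≢ i → f k ≡ 0) → ∑ n f ≡ f i
∑-supported (suc n) f zero f≡0 = begin
  f zero + ∑ n (f ∘ suc)    ≡⟨ cong (f zero +_) (∑-cong n (λ k → f≡0 (suc k) λ ())) ⟩
  f zero + ∑ n (λ _ → 0)    ≡⟨ cong (f zero +_) (trans (∑-const n 0) (*-zeroʳ n)) ⟩
  f zero + 0                ≡⟨ +-identityʳ (f zero) ⟩
  f zero                    ∎
  where open ≡-Reasoning
∑-supported (suc n) f (suc i) f≡0 =
  cong₂ _+_ (f≡0 zero λ ())
    (∑-supported n (f ∘ suc) i λ k k≢i → f≡0 (suc k) (k≢i ∘ F.suc-injective))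

∑-supported₂ : ∀ n (f : Fin n → ℕ) i j → i ≢ j → (∀ k → k ≢ i → k ≢ j → f k ≡ 0) →
  ∑ n f ≡ f i + f j
∑-supported₂ (suc n) f zero zero i≢j f≡0 = ⊥-elim (i≢j refl)
∑-supported₂ (suc n) f zero (suc j) i≢j f≡0 =
  cong (f zero +_) (∑-supported n (f ∘ suc) j λ k k≢j → f≡0 (suc k) (λ ()) (k≢j ∘ F.suc-injective))
∑-supported₂ (suc n) f (suc i) zero i≢j f≡0 =
  trans (cong (f zero +_)
           (∑-supported n (f ∘ suc) i λ k k≢i → f≡0 (suc k) (k≢i ∘ F.suc-injective) (λ ())))
        (+-comm (f zero) (f (suc i)))
∑-supported₂ (suc n) f (suc i) (suc j) i≢j f≡0 =
  cong₂ _+_ (f≡0 zero (λ ()) (λ ()))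
    (∑-supported₂ n (f ∘ suc) i j (i≢j ∘ cong suc) λ k k≢i k≢j →
      f≡0 (suc k) (k≢i ∘ F.suc-injective) (k≢j ∘ F.suc-injective))

term≤∑ : ∀ n (f : Fin n → ℕ) i → f i ≤ ∑ n f
term≤∑ (suc n) f zero    = m≤m+n (f zero) _
term≤∑ (suc n) f (suc i) = ≤-trans (term≤∑ n (f ∘ suc) i) (m≤n+m _ (f zero))

pair≤∑ : ∀ n (f : Fin n → ℕ) i j → i ≢ j → f i + f j ≤ ∑ n f
pair≤∑ (suc n) f zero    zero    i≢j = ⊥-elim (i≢j refl)
pair≤∑ (suc n) f zero    (suc j) i≢j = +-monoʳ-≤ (f zero) (term≤∑ n (f ∘ suc) j)
pair≤∑ (suc n) f (suc i) zero    i≢j =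
  subst (_≤ ∑ (suc n) f) (+-comm (f zero) _) (+-monoʳ-≤ (f zero) (term≤∑ n (f ∘ suc) i))
pair≤∑ (suc n) f (suc i) (suc j) i≢j =
  ≤-trans (pair≤∑ n (f ∘ suc) i j (i≢j ∘ cong suc)) (m≤n+m _ (f zero))

count : (n : ℕ) → (Fin n → Bool) → ℕ
count n p = ∑ n (λ a → if p a then 1 else 0)

count-all : ∀ n {p : Fin n → Bool} → (∀ a → T (p a)) → count n p ≡ n
count-all n {p} all = begin
  count n p        ≡⟨ ∑-cong n (λ a → cong (if_then 1 else 0) (T-≡ .to (all a))) ⟩
  ∑ n (λ _ → 1)    ≡⟨ ∑-const n 1 ⟩
  n * 1            ≡⟨ *-identityʳ n ⟩
  n                ∎
  where open ≡-Reasoning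

count-none : ∀ n {p : Fin n → Bool} → (∀ a → ¬ T (p a)) → count n p ≡ 0
count-none n none = begin
  count n _        ≡⟨ ∑-cong n (λ a → cong (if_then 1 else 0) (¬-not (none a ∘ T-≡ .from))) ⟩
  ∑ n (λ _ → 0)    ≡⟨ ∑-const n 0 ⟩
  n * 0            ≡⟨ *-zeroʳ n ⟩
  0                ∎
  where open ≡-Reasoning

count-singleton : ∀ n {p : Fin n → Bool} x → T (p x) → (∀ a → T (p a) → a ≡ x) → count n p ≡ 1
count-singleton n {p} x x∈p only-x =
  trans (∑-supported n _ x outside) (cong (if_then 1 else 0) (T-≡ .to x∈p))
  where
  outside : ∀ a → a ≢ x → (if p a then 1 else 0) ≡ 0
  outside a a≢x with p a in pa
  ... | true  = ⊥-elim (a≢x (only-x a (T-≡ .from pa)))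
  ... | false = refl

count≡0⇒∉ : ∀ n (p : Fin n → Bool) → count n p ≡ 0 → ∀ a → ¬ T (p a)
count≡0⇒∉ n p count≡0 a a∈p =
  n≮n 0 (subst₂ _≤_ (cong (if_then 1 else 0) (T-≡ .to a∈p)) count≡0 (term≤∑ n _ a))

length-filter-tabulate : ∀ {A : Set} n (f : Fin n → A) (p : A → Bool) →
  length (filter (Bool.T? ∘ p) (tabulate f)) ≡ count n (p ∘ f)
length-filter-tabulate zero    f p = refl
length-filter-tabulate (suc n) f p with p (f zero)
... | true  = cong suc (length-filter-tabulate n (f ∘ suc) p)
... | false = length-filter-tabulate n (f ∘ suc) p

sum-map-tabulate : ∀ {A : Set} n (f : Fin n → A) (g : A → ℕ) →
  sum (map g (tabulate f)) ≡ ∑ n (g ∘ f)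
sum-map-tabulate zero    f g = refl
sum-map-tabulate (suc n) f g = cong (g (f zero) +_) (sum-map-tabulate n (f ∘ suc) g)

card≡∑count : ∀ {m s} (J : PSubset m s) → card J ≡ ∑ m (λ i → count s (J i))
card≡∑count {m} {s} J =
  trans (sum-map-tabulate m id _) (∑-cong m (λ i → length-filter-tabulate s id (J i)))

UpClosed : ∀ {m s} → PSubset m s → Set
UpClosed {m} {s} J = ∀ i (a b : Fin s) → a F.≤ b → T (J i a) → T (J i b)

upClosed⇒antiIdeal : ∀ {m s} {J : PSubset m s} → UpClosed J → IsAntiIdeal J
upClosed⇒antiIdeal {J = J} up = (λ i a → not (J i a)) , ideal , λ i a → sym (not-involutive (J i a))
  where
  ideal : IsIdeal (λ i a → not (J i a))
  ideal i a b a≤b b∉J = T-not-≡ .from (¬-not λ a∈J →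
    subst T (T-not-≡ .to b∉J) (up i a b a≤b (T-≡ .from a∈J)))

antiIdeal⇒upClosed : ∀ {m s} {J : PSubset m s} → IsAntiIdeal J → UpClosed J
antiIdeal⇒upClosed (I , ideal , J≡¬I) i a b a≤b a∈J =
  subst T (sym (J≡¬I i b)) (T-not-≡ .from (¬-not λ b∈I →
    subst T (T-not-≡ .to (subst T (J≡¬I i a) a∈J)) (ideal i a b a≤b (T-≡ .from b∈I))))

countRows-mono : ∀ {N m m′ s s′ v} (A : Array N m s v) (B : Array N m′ s′ v) {J g J′ g′} →
  (∀ r → RowMatches A J g r → RowMatches B J′ g′ r) → countRows A J g ≤ countRows B J′ g′
countRows-mono {N} A B {J} {g} {J′} {g′} matches⇒ =
  length-mono-≤ (filter⁺ (rowMatches? A J g) (rowMatches? B J′ g′) (λ { refl → matches⇒ _ })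
                         (⊆-refl {x = allFin N}))

Covers : ∀ {N m s v} → ℕ → ℕ → Array N m s v → Set
Covers {m = m} {s} {v} λ' t A =
  ∀ J → IsAntiIdeal J → card J ≡ t → ∀ (g : Fin m → Fin s → Fin v) → λ' ≤ countRows A J g

raise : ∀ {m s} → PSubset m s → PSubset m (suc s)
raise J i zero    = false
raise J i (suc a) = J i a

raise-upClosed : ∀ {m s} {J : PSubset m s} → UpClosed J → UpClosed (raise J)
raise-upClosed up i zero    b       _         ()
raise-upClosed up i (suc a) (suc b) (s≤s a≤b) a∈J = up i a b a≤b a∈J

card-raise : ∀ {m s} (J : PSubset m s) → card (raise J) ≡ card J
card-raise J = trans (card≡∑count (raise J)) (sym (card≡∑count J))

dropBottom : ∀ {N m s v} → Array N m (suc s) v → Array N m s v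
dropBottom A r i a = A r i (suc a)

dropBottom-covers : ∀ {λ' t N m s v} (A : Array N m (suc s) (suc v)) →
  Covers λ' t A → Covers λ' t (dropBottom A)
dropBottom-covers {m = m} {s} {v} A covers J J-anti |J|≡t g = ≤-trans
  (covers (raise J) (upClosed⇒antiIdeal (raise-upClosed (antiIdeal⇒upClosed J-anti)))
    (trans (card-raise J) |J|≡t) extended-g)
  (countRows-mono A (dropBottom A) λ r matches i a a∈J → matches i (suc a) a∈J)
  where
  extended-g : Fin m → Fin (suc s) → Fin (suc v)
  extended-g i zero    = zero  -- arbitrary: the bottom level lies outside raise J
  extended-g i (suc a) = g i a

lower : ∀ {m s} → PSubset m (suc s) → PSubset m s
lower J i a = J i (suc a)

lower-upClosed : ∀ {m s} {J : PSubset m (suc s)} → UpClosed J → UpClosed (lower J)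
lower-upClosed up i a b a≤b = up i (suc a) (suc b) (s≤s a≤b)

card-lower : ∀ {m s} (J : PSubset m (suc s)) → (∀ i → J i zero ≡ false) → card (lower J) ≡ card J
card-lower {m} {s} J no-bottom = begin
  card (lower J)                     ≡⟨ card≡∑count (lower J) ⟩
  ∑ m (λ i → count s (lower J i))
    ≡⟨ ∑-cong m (λ i → cong (λ b → (if b then 1 else 0) + count s (lower J i)) (sym (no-bottom i))) ⟩
  ∑ m (λ i → count (suc s) (J i))    ≡⟨ sym (card≡∑count J) ⟩
  card J                             ∎
  where open ≡-Reasoning

bottom∈⇒⊆block : ∀ {m s} {J : PSubset m (suc s)} → UpClosed J → card J ≡ suc s →
  ∀ i → T (J i zero) → ∀ k a → T (J k a) → k ≡ i
bottom∈⇒⊆block {m} {s} {J} up |J|≡1+s i i₀∈J k a a∈J with k ≟ i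
... | yes k≡i = k≡i
... | no  k≢i = ⊥-elim (count≡0⇒∉ (suc s) (J k) block-k-empty a a∈J)
  where
  blockSize : Fin m → ℕ
  blockSize j = count (suc s) (J j)

  block-k-empty : blockSize k ≡ 0
  block-k-empty = n≤0⇒n≡0 (+-cancelʳ-≤ (suc s) (blockSize k) 0 (subst₂ _≤_
    (cong (blockSize k +_) (count-all (suc s) (λ b → up i zero b z≤n i₀∈J)))
    (trans (sym (card≡∑count J)) |J|≡1+s)
    (pair≤∑ m blockSize k i k≢i)))

blockAndTop : ∀ {m s} → Fin m → Fin m → PSubset m (suc s)
blockAndTop {s = s} i j k a = does (k ≟ i) ∨ (does (k ≟ j) ∧ does (a ≟ fromℕ s))

blockAndTop⁻ : ∀ {m s} (i j k : Fin m) (a : Fin (suc s)) →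
  T (blockAndTop i j k a) → k ≡ i ⊎ (k ≡ j × a ≡ fromℕ s)
blockAndTop⁻ {s = s} i j k a a∈ with k ≟ i | k ≟ j | a ≟ fromℕ s
... | yes k≡i | _       | _         = inj₁ k≡i
... | no _    | yes k≡j | yes a≡top = inj₂ (k≡j , a≡top)
... | no _    | yes _   | no _      = ⊥-elim a∈
... | no _    | no _    | _         = ⊥-elim a∈

blockAndTop⁺ : ∀ {m s} (i j k : Fin m) (a : Fin (suc s)) →
  k ≡ i ⊎ (k ≡ j × a ≡ fromℕ s) → T (blockAndTop i j k a)
blockAndTop⁺ i j k a (inj₁ k≡i) rewrite dec-true (k ≟ i) k≡i = _
blockAndTop⁺ {s = s} i j k a (inj₂ (k≡j , a≡top))
  rewrite dec-true (k ≟ j) k≡j | dec-true (a ≟ fromℕ s) a≡top = T-≡ .from (∨-zeroʳ _)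

blockAndTop-upClosed : ∀ {m s} (i j : Fin m) → UpClosed (blockAndTop {s = s} i j)
blockAndTop-upClosed i j k a b a≤b a∈ with blockAndTop⁻ i j k a a∈
... | inj₁ k≡i         = blockAndTop⁺ i j k b (inj₁ k≡i)
... | inj₂ (k≡j , refl) = blockAndTop⁺ i j k b (inj₂ (k≡j , F.≤-antisym (≤fromℕ b) a≤b))

card-blockAndTop : ∀ {m s} (i j : Fin m) → i ≢ j → card (blockAndTop {s = s} i j) ≡ suc (suc s)
card-blockAndTop {m} {s} i j i≢j = begin
  card (blockAndTop i j)   ≡⟨ card≡∑count (blockAndTop i j) ⟩
  ∑ m blockSize            ≡⟨ ∑-supported₂ m blockSize i j i≢j outside ⟩
  blockSize i + blockSize j
    ≡⟨ cong₂ _+_ (count-all (suc s) (λ a → blockAndTop⁺ i j i a (inj₁ refl)))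
                 (count-singleton (suc s) (fromℕ s)
                    (blockAndTop⁺ i j j (fromℕ s) (inj₂ (refl , refl))) only-top) ⟩
  suc s + 1                ≡⟨ +-comm (suc s) 1 ⟩
  suc (suc s)              ∎
  where
  open ≡-Reasoning
  blockSize : Fin m → ℕ
  blockSize k = count (suc s) (blockAndTop i j k)

  outside : ∀ k → k ≢ i → k ≢ j → blockSize k ≡ 0
  outside k k≢i k≢j = count-none (suc s) λ a a∈ → [ k≢i , k≢j ∘ proj₁ ] (blockAndTop⁻ i j k a a∈)

  only-top : ∀ a → T (blockAndTop i j j a) → a ≡ fromℕ s
  only-top a a∈ = [ (λ j≡i → ⊥-elim (i≢j (sym j≡i))) , proj₂ ] (blockAndTop⁻ i j j a a∈)

otherBlock : ∀ {m} → Fin (suc (suc m)) → Fin (suc (suc m))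
otherBlock zero    = suc zero
otherBlock (suc _) = zero

otherBlock-≢ : ∀ {m} (i : Fin (suc (suc m))) → i ≢ otherBlock i
otherBlock-≢ zero    ()
otherBlock-≢ (suc _) ()

addBottom : ∀ {N m s v} → Array N (suc (suc m)) (suc s) v → Array N (suc (suc m)) (suc (suc s)) v
addBottom {s = s} A r k zero    = A r (otherBlock k) (fromℕ s)
addBottom         A r k (suc a) = A r k a

addBottom-covers-bottomless : ∀ {λ' t N m s v} (A : Array N (suc (suc m)) (suc s) v) →
  Covers λ' t A →
  ∀ J → UpClosed J → (∀ i → J i zero ≡ false) → card J ≡ t → ∀ g → λ' ≤ countRows (addBottom A) J g
addBottom-covers-bottomless A covers J up no-bottom |J|≡t g = ≤-trans
  (covers (lower J) (upClosed⇒antiIdeal (lower-upClosed up)) (trans (card-lower J no-bottom) |J|≡t)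
    (λ i a → g i (suc a)))
  (countRows-mono A (addBottom A) matches⇒)
  where
  matches⇒ : ∀ r → RowMatches A (lower J) (λ i a → g i (suc a)) r → RowMatches (addBottom A) J g r
  matches⇒ r matches i zero    i₀∈J = ⊥-elim (subst T (no-bottom i) i₀∈J)
  matches⇒ r matches i (suc a) a∈J  = matches i a a∈J

addBottom-covers-block : ∀ {λ' N m s v} (A : Array N (suc (suc m)) (suc s) v) →
  Covers λ' (suc (suc s)) A → ∀ J → UpClosed J → card J ≡ suc (suc s) → ∀ i → T (J i zero) →
  ∀ g → λ' ≤ countRows (addBottom A) J g
addBottom-covers-block {m = m} {s} {v} A covers J up |J|≡t i i₀∈J g = ≤-trans
  (covers (blockAndTop i j) (upClosed⇒antiIdeal (blockAndTop-upClosed i j))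
    (card-blockAndTop i j (otherBlock-≢ i)) g′)
  (countRows-mono A (addBottom A) matches⇒)
  where
  j = otherBlock i

  g′ : Fin (suc (suc m)) → Fin (suc s) → Fin v
  g′ k a = if does (k ≟ j) then g i zero else g i (suc a)

  matches⇒ : ∀ r → RowMatches A (blockAndTop i j) g′ r → RowMatches (addBottom A) J g r
  matches⇒ r matches k a a∈J with bottom∈⇒⊆block up |J|≡t i i₀∈J k a a∈J
  matches⇒ r matches k zero a∈J | refl =
    trans (matches j (fromℕ s) (blockAndTop⁺ i j j (fromℕ s) (inj₂ (refl , refl))))
          (cong (if_then g i zero else _) (dec-true (j ≟ j) refl))
  matches⇒ r matches k (suc a) a∈J | refl =
    trans (matches i a (blockAndTop⁺ i j i a (inj₁ refl)))
          (cong (if_then _ else g i (suc a)) (dec-false (i ≟ j) (otherBlock-≢ i)))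

addBottom-covers : ∀ {λ' N m s v} (A : Array N (suc (suc m)) (suc s) v) →
  Covers λ' (suc (suc s)) A → Covers λ' (suc (suc s)) (addBottom A)
addBottom-covers A covers J J-anti |J|≡t g with any? (λ i → J i zero Bool.≟ true)
... | yes (i , i₀∈J) =
  addBottom-covers-block A covers J (antiIdeal⇒upClosed J-anti) |J|≡t i (T-≡ .from i₀∈J) g
... | no no-bottom =
  addBottom-covers-bottomless A covers J (antiIdeal⇒upClosed J-anti)
    (λ i → ¬-not λ i₀∈J → no-bottom (i , i₀∈J)) |J|≡t g

corollary1 : (N t m v λ' : ℕ) → 1 ≤ N → 1 ≤ t → 1 ≤ m → 1 ≤ v → 1 ≤ λ' →
    2 ≤ t → t ≤ m * (t ∸ 1) →
    OCAExists λ' N t m t v ⇔ OCAExists λ' N t m (t ∸ 1) v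
corollary1 N zero          m             v       λ' _ () _ _ _ _ _
corollary1 N (suc zero)    m             v       λ' _ _ _ _ _ (s≤s ()) _
corollary1 N (suc (suc s)) zero          v       λ' _ _ () _ _ _ _
corollary1 N (suc (suc s)) (suc (suc m)) zero    λ' _ _ _ () _ _ _
corollary1 N (suc (suc s)) (suc zero)    v       λ' _ _ _ _ _ _ t≤m[t-1] =
  ⊥-elim (n≮n (suc s) (subst (suc (suc s) ≤_) (*-identityˡ (suc s)) t≤m[t-1]))
corollary1 N (suc (suc s)) (suc (suc m)) (suc v) λ' _ _ _ _ _ 2≤t t≤m[t-1] = mk⇔
  (λ (A , _ , _ , covers) → dropBottom A , 2≤t , t≤m[t-1] , dropBottom-covers A covers)
  (λ (A , _ , _ , covers) → addBottom A , 2≤t , m≤m+n (suc (suc s)) _ , addBottom-covers A covers)
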